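{- Let $n\geq 1$, let $x_1<x_2<\cdots$ be the increasing enumeration of $M_{p_n}$, let $d_k=x_{k+1}-x_k$, and let $T=T_{p_n}$ be the minimal period of $(d_k)_{k\geq1}$. Then the last element of the pattern is $d_T=2$.
   Context: $p_1=2<p_2=3<p_3=5<\cdots$ denotes the sequence of all primes. For $n\geq1$, $M_{p_n}$ is the set of positive integers not divisible by any of $p_1,\dots,p_n$. The pattern $\mathcal{P}_{p_n}=(d_1,\dots,d_T)$ is one minimal period of the gap sequence, starting from $x_1=1$. -}

module Defs where

open import Data.Nat using (ℕ; suc; _+_; _∸_; _≤_; _<_)
open import Data.Nat.Divisibility using (_∣_)
open import Data.Nat.Primality using (Prime)
open import Data.Product using (Σ; _×_)
open import Relation.Nullary using (¬_)
open import Relation.Binary.PropositionalEquality using (_≡_)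

-- M_q : positive integers not divisible by any prime p ≤ q.
-- For q = p_n (the n-th prime) the primes ≤ q are exactly p_1, …, p_n.
InM : ℕ → ℕ → Set
InM q m = (1 ≤ m) × ((p : ℕ) → Prime p → p ≤ q → ¬ (p ∣ m))

-- x (indexed from 1; x 0 is ignored) is the increasing enumeration of M_q.
IsEnumeration : ℕ → (ℕ → ℕ) → Set
IsEnumeration q x =
  ((k : ℕ) → 1 ≤ k → x k < x (suc k)) ×
  ((k : ℕ) → 1 ≤ k → InM q (x k)) ×
  ((m : ℕ) → InM q m → Σ ℕ (λ k → (1 ≤ k) × (x k ≡ m)))

gaps : (ℕ → ℕ) → ℕ → ℕ
gaps x k = x (suc k) ∸ x k

IsPeriod : (ℕ → ℕ) → ℕ → Set
IsPeriod d T = (1 ≤ T) × ((k : ℕ) → 1 ≤ k → d (k + T) ≡ d k)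

IsMinimalPeriod : (ℕ → ℕ) → ℕ → Set
IsMinimalPeriod d T = IsPeriod d T × ((T' : ℕ) → IsPeriod d T' → T ≤ T')

module Submission where

-- Let c = x_{T+1} − x_1 be the growth of the enumeration over one period.
-- Periodicity of the gaps means the enumeration is translation invariant,
-- x_{i+T} = x_i + c, and since x_1 = 1 the whole progression 1 + j·c
-- (j ≥ 0) lies in M_q.  A prime p not dividing c is coprime to c, so by
-- Bézout p divides some 1 + j·c; hence every prime p ≤ q divides c.  In
-- particular c is even and c ≥ 2, so c ∉ M_q while c − 1 ∈ M_q (a prime
-- ≤ q dividing c − 1 would also divide c, hence 1).  As x_{T+1} = c + 1,
-- the element of M_q just before it is c − 1, i.e. d_T = 2.

open import Defs
open import Data.Nat using (ℕ)
open import Data.Nat.Primality using (Prime)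
open import Relation.Binary.PropositionalEquality using (_≡_)

open import Data.Nat using (suc; _+_; _*_; _∸_; _≤_; _<_; _≤?_; z≤n; s≤s; s≤s⁻¹; nonTrivial⇒n>1; nonTrivial⇒≢1)
open import Data.Nat.Properties
open import Data.Nat.Divisibility using (_∣_; divides; _∣?_; ∣1⇒≡1; ∣m+n∣m⇒∣n)
open import Data.Nat.Primality using (prime⇒irreducible; prime⇒nonTrivial; prime[2]; ¬prime[0])
open import Data.Nat.Coprimality using (Coprime; coprime-Bézout)
open import Data.Nat.GCD using (module Bézout)
open import Data.Product using (Σ; _×_; _,_; proj₁; proj₂)
open import Data.Sum using (inj₁; inj₂)
open import Relation.Nullary using (¬_; yes; no; contradiction)
open import Relation.Binary.PropositionalEquality using (_≢_; refl; sym; trans; cong; cong₂; subst; module ≡-Reasoning)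
open import Data.Nat.Tactic.RingSolver using (solve-∀)

prime⇒≥2 : ∀ {p} → Prime p → 2 ≤ p
prime⇒≥2 {p} pp = nonTrivial⇒n>1 p {{prime⇒nonTrivial pp}}

prime∤1 : ∀ {p} → Prime p → ¬ p ∣ 1
prime∤1 pp p∣1 = nonTrivial⇒≢1 {{prime⇒nonTrivial pp}} (∣1⇒≡1 p∣1)

prime∤⇒coprime : ∀ {p c} → Prime p → ¬ p ∣ c → Coprime p c
prime∤⇒coprime pp p∤c (d∣p , d∣c) with prime⇒irreducible pp d∣p
... | inj₁ d≡1 = d≡1
... | inj₂ refl = contradiction d∣c p∤c

-- Bézout gives 1 + b·c = a·n, or 1 + a·n = b·c; in the
-- latter case j = (n − 1)·b works, since 1 + (n−1)(1 + a·n) = (1 + (n−1)·a)·n.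
coprime⇒progression-meets-multiple : ∀ n c → Coprime (suc n) c →
  Σ ℕ λ j → suc n ∣ 1 + j * c
coprime⇒progression-meets-multiple n c cop with coprime-Bézout cop
... | Bézout.+- a b 1+bc≡an = b , divides a 1+bc≡an
... | Bézout.-+ a b 1+an≡bc = n * b , divides (1 + n * a) (begin
    1 + n * b * c            ≡⟨ cong suc (*-assoc n b c) ⟩
    1 + n * (b * c)          ≡⟨ cong (λ z → 1 + n * z) (sym 1+an≡bc) ⟩
    1 + n * (1 + a * suc n)  ≡⟨ factor n a ⟩
    (1 + n * a) * suc n      ∎)
  where
    open ≡-Reasoning
    factor : ∀ n a → 1 + n * (1 + a * suc n) ≡ (1 + n * a) * suc n
    factor = solve-∀

avoids-progression⇒∣ : ∀ {p c} → Prime p → (∀ j → ¬ p ∣ 1 + j * c) → p ∣ c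
avoids-progression⇒∣ {p} {c} pp avoids with p ∣? c
... | yes p∣c = p∣c
avoids-progression⇒∣ {0} pp avoids | no _ = contradiction pp ¬prime[0]
avoids-progression⇒∣ {suc n} {c} pp avoids | no p∤c
  with coprime⇒progression-meets-multiple n c (prime∤⇒coprime pp p∤c)
... | j , p∣1+jc = contradiction p∣1+jc (avoids j)

one∈M : ∀ q → InM q 1
one∈M q = ≤-refl , λ p pp _ → prime∤1 pp

predecessor∈M : ∀ q m → 1 ≤ m → (∀ p → Prime p → p ≤ q → p ∣ suc m) → InM q m
predecessor∈M q m m≥1 divides-m+1 = m≥1 , λ p pp p≤q p∣m →
  prime∤1 pp (∣m+n∣m⇒∣n (subst (p ∣_) (+-comm 1 m) (divides-m+1 p pp p≤q)) p∣m)

positive-even⇒suc-of-positive : ∀ c → 1 ≤ c → 2 ∣ c → Σ ℕ λ m → (c ≡ suc m) × (1 ≤ m)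
positive-even⇒suc-of-positive 1 _ 2∣1 = contradiction 2∣1 (prime∤1 prime[2])
positive-even⇒suc-of-positive (suc (suc m)) _ _ = suc m , refl , s≤s z≤n

even∉M : ∀ q m → 2 ≤ q → 2 ∣ m → ¬ InM q m
even∉M q m 2≤q 2∣m (_ , avoids) = avoids 2 prime[2] 2≤q 2∣m

module Increasing (x : ℕ → ℕ) (inc : ∀ k → 1 ≤ k → x k < x (suc k)) where

  mono-+ : ∀ {k} i → 1 ≤ k → x k ≤ x (i + k)
  mono-+ 0 k≥1 = ≤-refl
  mono-+ {k} (suc i) k≥1 =
    ≤-trans (mono-+ i k≥1) (<⇒≤ (inc (i + k) (≤-trans k≥1 (m≤n+m k i))))

  mono-≤ : ∀ {k j} → 1 ≤ k → k ≤ j → x k ≤ x j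
  mono-≤ {k} {j} k≥1 k≤j =
    subst (λ i → x k ≤ x i) (m∸n+n≡m k≤j) (mono-+ (j ∸ k) k≥1)

  mono-< : ∀ {k j} → 1 ≤ k → k < j → x k < x j
  mono-< {k} k≥1 k<j = <-≤-trans (inc k k≥1) (mono-≤ (s≤s z≤n) k<j)

  below-next⇒≤ : ∀ {j k} → 1 ≤ j → x j < x (suc k) → j ≤ k
  below-next⇒≤ {j} {k} j≥1 xj<xk+1 with j ≤? k
  ... | yes j≤k = j≤k
  ... | no j≰k = contradiction xj<xk+1 (≤⇒≯ (mono-≤ (s≤s z≤n) (≰⇒> j≰k)))

  next≡+gap : ∀ k → 1 ≤ k → x (suc k) ≡ x k + gaps x k
  next≡+gap k k≥1 = sym (m+[n∸m]≡n (<⇒≤ (inc k k≥1)))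

module PeriodicGaps (x : ℕ → ℕ) (inc : ∀ k → 1 ≤ k → x k < x (suc k))
                    {T : ℕ} (period : IsPeriod (gaps x) T) where
  open Increasing x inc

  growth : ℕ
  growth = x (suc T) ∸ x 1

  growth≥1 : 1 ≤ growth
  growth≥1 = m<n⇒0<n∸m (mono-< ≤-refl (s≤s (proj₁ period)))

  translate : ∀ i → x (suc i + T) ≡ x (suc i) + growth
  translate 0 = sym (m+[n∸m]≡n (<⇒≤ (mono-< ≤-refl (s≤s (proj₁ period)))))
  translate (suc i) = begin
    x (suc (suc i + T))                     ≡⟨ next≡+gap (suc i + T) (s≤s z≤n) ⟩
    x (suc i + T) + gaps x (suc i + T)      ≡⟨ cong₂ _+_ (translate i) (proj₂ period (suc i) (s≤s z≤n)) ⟩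
    x (suc i) + growth + gaps x (suc i)     ≡⟨ +-swapʳ (x (suc i)) growth (gaps x (suc i)) ⟩
    x (suc i) + gaps x (suc i) + growth     ≡⟨ cong (_+ growth) (sym (next≡+gap (suc i) (s≤s z≤n))) ⟩
    x (suc (suc i)) + growth                ∎
    where
      open ≡-Reasoning
      +-swapʳ : ∀ a b c → a + b + c ≡ a + c + b
      +-swapʳ = solve-∀

  progression : ∀ j → x (1 + j * T) ≡ x 1 + j * growth
  progression 0 = sym (+-identityʳ (x 1))
  progression (suc j) = begin
    x (suc (T + j * T))           ≡⟨ cong (λ i → x (suc i)) (+-comm T (j * T)) ⟩
    x (suc (j * T) + T)           ≡⟨ translate (j * T) ⟩
    x (1 + j * T) + growth        ≡⟨ cong (_+ growth) (progression j) ⟩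
    x 1 + j * growth + growth     ≡⟨ +-assoc (x 1) (j * growth) growth ⟩
    x 1 + (j * growth + growth)   ≡⟨ cong (x 1 +_) (+-comm (j * growth) growth) ⟩
    x 1 + (growth + j * growth)   ∎
    where open ≡-Reasoning

module Enumeration {q : ℕ} {x : ℕ → ℕ} (E : IsEnumeration q x) where
  open Increasing x (proj₁ E) public

  member : ∀ k → 1 ≤ k → InM q (x k)
  member = proj₁ (proj₂ E)

  enumerates : ∀ m → InM q m → Σ ℕ λ k → (1 ≤ k) × (x k ≡ m)
  enumerates = proj₂ (proj₂ E)

  first≡1 : x 1 ≡ 1
  first≡1 with enumerates 1 (one∈M q)
  ... | k , k≥1 , xk≡1 =
    ≤-antisym (subst (x 1 ≤_) xk≡1 (mono-≤ ≤-refl k≥1)) (proj₁ (member 1 ≤-refl))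

  below-next⇒≤-current : ∀ {k m} → InM q m → m < x (suc k) → m ≤ x k
  below-next⇒≤-current {k} m∈M m<xk+1 with enumerates _ m∈M
  ... | j , j≥1 , xj≡m =
    subst (_≤ x k) xj≡m (mono-≤ j≥1 (below-next⇒≤ j≥1 (subst (_< x (suc k)) (sym xj≡m) m<xk+1)))

  gap≡2 : ∀ {k m} → 1 ≤ k → x (suc k) ≡ 2 + m → InM q m → ¬ InM q (1 + m) →
    gaps x k ≡ 2
  gap≡2 {k} {m} k≥1 xk+1≡2+m m∈M 1+m∉M = begin
    x (suc k) ∸ x k    ≡⟨ cong₂ _∸_ xk+1≡2+m xk≡m ⟩
    2 + m ∸ m          ≡⟨ m+n∸n≡m 2 m ⟩
    2                  ∎
    where
      open ≡-Reasoning
      xk<2+m : x k < 2 + m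
      xk<2+m = subst (x k <_) xk+1≡2+m (proj₁ E k k≥1)
      xk≢1+m : x k ≢ 1 + m
      xk≢1+m xk≡1+m = 1+m∉M (subst (InM q) xk≡1+m (member k k≥1))
      xk≡m : x k ≡ m
      xk≡m = ≤-antisym (s≤s⁻¹ (≤∧≢⇒< (s≤s⁻¹ xk<2+m) xk≢1+m))
                       (below-next⇒≤-current m∈M (subst (m <_) (sym xk+1≡2+m) (s≤s (n≤1+n m))))

corollary2 : (q : ℕ) → Prime q → (x : ℕ → ℕ) → IsEnumeration q x →
    (T : ℕ) → IsMinimalPeriod (gaps x) T → gaps x T ≡ 2
corollary2 q q-prime x E T minimal = gap≡2 (proj₁ period) xT+1≡2+c' c'∈M c∉M
  where
    period : IsPeriod (gaps x) T
    period = proj₁ minimal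
    open Enumeration E
    open PeriodicGaps x (proj₁ E) period

    progression⊆M : ∀ j → InM q (1 + j * growth)
    progression⊆M j = subst (InM q) (trans (progression j) (cong (_+ j * growth) first≡1))
                                    (member (1 + j * T) (s≤s z≤n))

    primes∣growth : ∀ p → Prime p → p ≤ q → p ∣ growth
    primes∣growth p pp p≤q = avoids-progression⇒∣ pp (λ j → proj₂ (progression⊆M j) p pp p≤q)

    2≤q : 2 ≤ q
    2≤q = prime⇒≥2 q-prime

    growth≡1+c'∧c'≥1 : Σ ℕ λ c' → (growth ≡ suc c') × (1 ≤ c')
    growth≡1+c'∧c'≥1 = positive-even⇒suc-of-positive growth growth≥1 (primes∣growth 2 prime[2] 2≤q)

    c' : ℕ
    c' = proj₁ growth≡1+c'∧c'≥1

    growth≡1+c' : growth ≡ suc c'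
    growth≡1+c' = proj₁ (proj₂ growth≡1+c'∧c'≥1)

    xT+1≡2+c' : x (suc T) ≡ 2 + c'
    xT+1≡2+c' = trans (translate 0) (cong₂ _+_ first≡1 growth≡1+c')

    c'∈M : InM q c'
    c'∈M = predecessor∈M q c' (proj₂ (proj₂ growth≡1+c'∧c'≥1))
             (λ p pp p≤q → subst (p ∣_) growth≡1+c' (primes∣growth p pp p≤q))

    c∉M : ¬ InM q (1 + c')
    c∉M = even∉M q (1 + c') 2≤q (subst (2 ∣_) growth≡1+c' (primes∣growth 2 prime[2] 2≤q))
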